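{- Let $x\ge2$ and $n\ge1$ be integers; write $n=qx+r$ with $0\le r<x$, and for $0\le k<x$ let $q^*_k=q$ if $k<r$ and $q^*_k=q-1$ otherwise (so $q^*_kx+k$ is the largest element of $\{0,\dots,n-1\}$ congruent to $k$ mod $x$). Let $L$ be a multiset of size $n-1$ having a standard linear realization $P$. Suppose that for some $0\le k<k+1<x$ with $q^*_k=q^*_{k+1}=:q^*$ and some integer $0\le s\le q^*$, the path $P$ contains, as consecutive vertices (in this order or its reverse), $sx+k,(s+1)x+k,\dots,q^*x+k,\;q^*x+k+1,(q^*-1)x+k+1,\dots,sx+k+1$. Let $w=q^*-s$ and let $M$ be a multiset of size $w$ that has a standard linear realization. Then $(L\setminus\{x^{2w}\})\cup xM\cup xM$ has a standard linear realization.
   Context: $K_n$ is the complete graph on vertex set $\{0,\dots,n-1\}$; the linear length of an edge $\{u,w\}$ is $|u-w|$. A multiset of size $n-1$ has a linear realization if some Hamiltonian path in $K_n$ has multiset of linear edge lengths equal to it; it is standard if the path starts at $0$. $\{x^{m}\}$ is the multiset consisting of $x$ with multiplicity $m$; $\setminus$ and $\cup$ are multiset difference and union; $xM=\{xm: m\in M\}$ (with multiplicities). -}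

module Defs where

open import Data.Nat using (ℕ; zero; suc; _+_; _*_; _∸_; _<ᵇ_; ∣_-_∣)
open import Data.Nat.DivMod using (_/_; _%_)
open import Data.Nat.Base using (NonZero)
open import Data.Integer as ℤ using (ℤ; +_)
open import Data.Bool using (if_then_else_)
open import Relation.Nullary using (yes; no)
open import Data.Nat using (_≟_)
import Data.List
open import Data.List using (List; []; _∷_; _++_; map; reverse; upTo)
open import Data.List.Relation.Binary.Permutation.Propositional using (_↭_)
open import Data.Product using (Σ; ∃; _×_)
open import Relation.Binary.PropositionalEquality using (_≡_)

edgeLengths : List ℕ → List ℕ
edgeLengths []           = []
edgeLengths (a ∷ [])     = []
edgeLengths (a ∷ b ∷ t)  = ∣ a - b ∣ ∷ edgeLengths (b ∷ t)

IsHamPath : ℕ → List ℕ → Set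
IsHamPath n P = P ↭ upTo n

IsStdHamPath : ℕ → List ℕ → Set
IsStdHamPath n P = IsHamPath n P × ∃ λ t → P ≡ 0 ∷ t

-- P is a standard linear realization (in K_n) of the multiset L (lists up to permutation)
IsStdLinReal : ℕ → List ℕ → List ℕ → Set
IsStdLinReal n L P = IsStdHamPath n P × edgeLengths P ↭ L

HasStdLinReal : List ℕ → Set
HasStdLinReal L = ∃ λ P → IsStdLinReal (suc (Data.List.length L)) L P

delete : ℕ → List ℕ → List ℕ
delete a [] = []
delete a (b ∷ t) with a ≟ b
... | yes _ = t
... | no  _ = b ∷ delete a t

_∖_ : List ℕ → List ℕ → List ℕ
L ∖ []      = L
L ∖ (a ∷ t) = delete a L ∖ t

-- q*_k for n = q x + r (as an integer; it can be -1)
qstar : (n x k : ℕ) → .{{_ : NonZero x}} → ℤ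
qstar n x k = if k <ᵇ (n % x) then + (n / x) else (+ (n / x)) ℤ.- (+ 1)

-- the vertex sequence sx+k,(s+1)x+k,…,q*x+k, q*x+k+1,…,sx+k+1  where q* = s + w
segment : (x k s w : ℕ) → List ℕ
segment x k s w =
  map (λ j → (s + j) * x + k) (upTo (suc w)) ++
  map (λ j → (s + j) * x + suc k) (reverse (upTo (suc w)))

IsInfix : List ℕ → List ℕ → Set
IsInfix xs P = ∃ λ A → ∃ λ B → P ≡ A ++ xs ++ B

-- The given segment is a ladder: it climbs column k (vertices (s + j) x + k) through the rows
-- j = 0, …, w, crosses by an edge of length 1 and descends column k + 1 through the same rows.
-- Its edge lengths are therefore x (2w times) and 1. Re-route it: climb column k in the row
-- order of a standard realization σ of M and descend column k + 1 in the reverse order. The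
-- vertex set and both endpoints are unchanged, so the path stays a standard Hamiltonian path;
-- since j ↦ (s + j) x + c multiplies distances by x, the new edge lengths are x M twice,
-- plus the same crossing edge of length 1.
module Submission where

open import Defs
open import Data.Nat using (ℕ; suc; _+_; _*_; _∸_; _≤_; _<_; _≥_)
open import Data.Integer using (+_)
open import Data.Nat.Properties using (m<n⇒0<n)
import Data.Nat
open import Data.List using (List; _++_; map; reverse; length; replicate)
open import Data.List.Relation.Binary.Permutation.Propositional using (_↭_)
open import Data.Product using (_×_)
open import Data.Sum using (_⊎_)
open import Relation.Binary.PropositionalEquality using (_≡_)

open import Data.Empty using (⊥-elim)
open import Data.Nat using (zero; _≟_; ∣_-_∣)
open import Data.Nat.Properties
  using (∣-∣-comm; ∣m+n-m+o∣≡∣n-o∣; *-distribʳ-∣-∣; *-comm; +-comm; +-identityʳ; *-identityʳ)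
open import Data.List using ([]; _∷_; _∷ʳ_; upTo; applyUpTo; initLast; _∷ʳ′_)
open import Data.List.Properties
  using (++-assoc; map-++; unfold-reverse; reverse-++; reverse-map; reverse-involutive;
         map-replicate; length-upTo; ∷ʳ-++)
open import Data.List.Membership.Propositional using (_∈_)
open import Data.List.Relation.Unary.Any using (here; there)
open import Data.List.Relation.Binary.Permutation.Propositional
  using (↭-refl; ↭-prep; ↭-swap; ↭-trans; ↭-sym; module PermutationReasoning)
open import Data.List.Relation.Binary.Permutation.Propositional.Properties
  using (∈-resp-↭; ↭-length; ++⁺; ++⁺ˡ; ++⁺ʳ; map⁺; drop-∷; shift; shifts; ++-comm; ∷↭∷ʳ; ↭-reverse)
open import Data.Product using (∃; _,_; proj₂)
open import Data.Sum using (inj₁; inj₂)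
open import Relation.Nullary using (yes; no)
open import Relation.Binary.PropositionalEquality
  using (refl; sym; trans; cong; cong₂; subst; module ≡-Reasoning)

edgeLengths-++-∷ : ∀ xs a ys →
  edgeLengths (xs ++ a ∷ ys) ≡ edgeLengths (xs ∷ʳ a) ++ edgeLengths (a ∷ ys)
edgeLengths-++-∷ []           a ys = refl
edgeLengths-++-∷ (b ∷ [])     a ys = refl
edgeLengths-++-∷ (b ∷ c ∷ xs) a ys = cong (∣ b - c ∣ ∷_) (edgeLengths-++-∷ (c ∷ xs) a ys)

edgeLengths-∷ʳ-++ : ∀ xs a b ys →
  edgeLengths (xs ∷ʳ a ++ b ∷ ys) ≡ edgeLengths (xs ∷ʳ a) ++ ∣ a - b ∣ ∷ edgeLengths (b ∷ ys)
edgeLengths-∷ʳ-++ xs a b ys =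
  trans (cong edgeLengths (∷ʳ-++ xs a (b ∷ ys))) (edgeLengths-++-∷ xs a (b ∷ ys))

edgeLengths-reverse : ∀ xs → edgeLengths (reverse xs) ≡ reverse (edgeLengths xs)
edgeLengths-reverse []           = refl
edgeLengths-reverse (a ∷ [])     = refl
edgeLengths-reverse (a ∷ b ∷ zs) = begin
  edgeLengths (reverse (a ∷ b ∷ zs))
    ≡⟨ cong edgeLengths (trans (unfold-reverse a (b ∷ zs)) (cong (_∷ʳ a) (unfold-reverse b zs))) ⟩
  edgeLengths (reverse zs ∷ʳ b ∷ʳ a)
    ≡⟨ edgeLengths-∷ʳ-++ (reverse zs) b a [] ⟩
  edgeLengths (reverse zs ∷ʳ b) ∷ʳ ∣ b - a ∣
    ≡⟨ cong₂ _∷ʳ_ (cong edgeLengths (unfold-reverse b zs)) (∣-∣-comm a b) ⟨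
  edgeLengths (reverse (b ∷ zs)) ∷ʳ ∣ a - b ∣
    ≡⟨ cong (_∷ʳ ∣ a - b ∣) (edgeLengths-reverse (b ∷ zs)) ⟩
  reverse (edgeLengths (b ∷ zs)) ∷ʳ ∣ a - b ∣
    ≡⟨ unfold-reverse ∣ a - b ∣ (edgeLengths (b ∷ zs)) ⟨
  reverse (edgeLengths (a ∷ b ∷ zs)) ∎
  where open ≡-Reasoning

length-edgeLengths : ∀ a xs → length (edgeLengths (a ∷ xs)) ≡ length xs
length-edgeLengths a []       = refl
length-edgeLengths a (b ∷ xs) = cong suc (length-edgeLengths b xs)

Scales : ℕ → (ℕ → ℕ) → Set
Scales x f = ∀ a b → ∣ f a - f b ∣ ≡ x * ∣ a - b ∣

edgeLengths-map : ∀ {x f} → Scales x f →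
  ∀ xs → edgeLengths (map f xs) ≡ map (x *_) (edgeLengths xs)
edgeLengths-map         f-scales []           = refl
edgeLengths-map         f-scales (a ∷ [])     = refl
edgeLengths-map {x} {f} f-scales (a ∷ b ∷ xs) =
  cong₂ _∷_ (f-scales a b) (edgeLengths-map {x} {f} f-scales (b ∷ xs))

∣n-suc[n]∣≡1 : ∀ n → ∣ n - suc n ∣ ≡ 1
∣n-suc[n]∣≡1 zero    = refl
∣n-suc[n]∣≡1 (suc n) = ∣n-suc[n]∣≡1 n

edgeLengths-applyUpTo : ∀ {f} → (∀ i → f (suc i) ≡ suc (f i)) →
  ∀ w → edgeLengths (applyUpTo f (suc w)) ≡ replicate w 1
edgeLengths-applyUpTo         f-suc zero    = refl
edgeLengths-applyUpTo {f = f} f-suc (suc w) =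
  cong₂ _∷_ (trans (cong ∣ f 0 -_∣ (f-suc 0)) (∣n-suc[n]∣≡1 (f 0)))
            (edgeLengths-applyUpTo (λ i → f-suc (suc i)) w)

replicate-+ : ∀ {A : Set} m n (a : A) → replicate (m + n) a ≡ replicate m a ++ replicate n a
replicate-+ zero    n a = refl
replicate-+ (suc m) n a = cong (a ∷_) (replicate-+ m n a)

delete-∈ : ∀ {a L} → a ∈ L → L ↭ a ∷ delete a L
delete-∈ {a} {b ∷ L} a∈ with a ≟ b
... | yes refl = ↭-refl
delete-∈ {a} {b ∷ L} (here a≡b)  | no a≢b = ⊥-elim (a≢b a≡b)
delete-∈ {a} {b ∷ L} (there a∈L) | no _   = ↭-trans (↭-prep b (delete-∈ a∈L)) (↭-swap b a ↭-refl)

delete-↭ : ∀ {a L Z} → L ↭ a ∷ Z → delete a L ↭ Z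
delete-↭ L↭a∷Z =
  drop-∷ (↭-trans (↭-sym (delete-∈ (∈-resp-↭ (↭-sym L↭a∷Z) (here refl)))) L↭a∷Z)

∖-↭ : ∀ {L} D {Z} → L ↭ D ++ Z → L ∖ D ↭ Z
∖-↭ []      L↭Z      = L↭Z
∖-↭ (a ∷ D) L↭a∷D++Z = ∖-↭ D (delete-↭ L↭a∷D++Z)

↭-splice : ∀ {L X T T′ Z D C Y} →
  X ++ T ++ Z ↭ L → T ↭ D ++ C → T′ ↭ Y ++ C → X ++ T′ ++ Z ↭ (L ∖ D) ++ Y
↭-splice {L} {X} {T} {T′} {Z} {D} {C} {Y} eL eT eT′ = begin
  X ++ T′ ++ Z       ↭⟨ ++⁺ˡ X (++⁺ʳ Z eT′) ⟩
  X ++ (Y ++ C) ++ Z ≡⟨ cong (X ++_) (++-assoc Y C Z) ⟩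
  X ++ Y ++ C ++ Z   ↭⟨ shifts X Y ⟩
  Y ++ X ++ C ++ Z   ↭⟨ ++-comm Y _ ⟩
  (X ++ C ++ Z) ++ Y ↭⟨ ++⁺ʳ Y (∖-↭ D L↭D++rest) ⟨
  (L ∖ D) ++ Y       ∎
  where
  open PermutationReasoning
  L↭D++rest : L ↭ D ++ X ++ C ++ Z
  L↭D++rest = begin
    L                  ↭⟨ eL ⟨
    X ++ T ++ Z        ↭⟨ ++⁺ˡ X (++⁺ʳ Z eT) ⟩
    X ++ (D ++ C) ++ Z ≡⟨ cong (X ++_) (++-assoc D C Z) ⟩
    X ++ D ++ C ++ Z   ↭⟨ shifts X D ⟩
    D ++ X ++ C ++ Z   ∎

edgeLengths-splice : ∀ A a I b B →
  edgeLengths (A ++ (a ∷ I ++ b ∷ []) ++ B)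
    ≡ edgeLengths (A ∷ʳ a) ++ edgeLengths (a ∷ I ++ b ∷ []) ++ edgeLengths (b ∷ B)
edgeLengths-splice A a I b B = begin
  edgeLengths (A ++ a ∷ (I ++ b ∷ []) ++ B)
    ≡⟨ edgeLengths-++-∷ A a _ ⟩
  edgeLengths (A ∷ʳ a) ++ edgeLengths (a ∷ (I ++ b ∷ []) ++ B)
    ≡⟨ cong (λ R → edgeLengths (A ∷ʳ a) ++ edgeLengths (a ∷ R)) (++-assoc I (b ∷ []) B) ⟩
  edgeLengths (A ∷ʳ a) ++ edgeLengths ((a ∷ I) ++ b ∷ B)
    ≡⟨ cong (edgeLengths (A ∷ʳ a) ++_) (edgeLengths-++-∷ (a ∷ I) b B) ⟩
  edgeLengths (A ∷ʳ a) ++ edgeLengths (a ∷ I ++ b ∷ []) ++ edgeLengths (b ∷ B) ∎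
  where open ≡-Reasoning

replace-after-head : ∀ A {a R R′ t} → A ++ a ∷ R ≡ 0 ∷ t → ∃ λ t′ → A ++ a ∷ R′ ≡ 0 ∷ t′
replace-after-head []      refl = _ , refl
replace-after-head (_ ∷ A) refl = _ , refl

replace-interior : ∀ {n L A B T T′ a b I I′ D C Y} →
  T ≡ a ∷ I ++ b ∷ [] → T′ ≡ a ∷ I′ ++ b ∷ [] → I′ ↭ I →
  edgeLengths T ↭ D ++ C → edgeLengths T′ ↭ Y ++ C →
  IsStdLinReal n L (A ++ T ++ B) → IsStdLinReal n ((L ∖ D) ++ Y) (A ++ T′ ++ B)
replace-interior {L = L} {A} {B} {a = a} {b} {I} {I′} {D} {C} {Y} refl refl I′↭I eT eT′ ((ham , start) , eL) =
  (↭-trans vertices ham , replace-after-head A (proj₂ start)) , edges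
  where
  vertices : A ++ (a ∷ I′ ++ b ∷ []) ++ B ↭ A ++ (a ∷ I ++ b ∷ []) ++ B
  vertices = ++⁺ˡ A (++⁺ʳ B (↭-prep a (++⁺ʳ (b ∷ []) I′↭I)))
  edges : edgeLengths (A ++ (a ∷ I′ ++ b ∷ []) ++ B) ↭ (L ∖ D) ++ Y
  edges = subst (_↭ (L ∖ D) ++ Y) (sym (edgeLengths-splice A a I′ b B))
            (↭-splice {X = edgeLengths (A ∷ʳ a)} {Z = edgeLengths (b ∷ B)} {D = D} {C} {Y}
                      (subst (_↭ L) (edgeLengths-splice A a I b B) eL) eT eT′)

IsStdLinReal⇒HasStdLinReal : ∀ {n L P} → IsStdLinReal n L P → HasStdLinReal L
IsStdLinReal⇒HasStdLinReal {n} {L} {P} real@((ham , (t , refl)) , eL) =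
  P , subst (λ m → IsStdLinReal m L P) n≡1+|L| real
  where
  open ≡-Reasoning
  n≡1+|L| : n ≡ suc (length L)
  n≡1+|L| = begin
    n                                   ≡⟨ length-upTo n ⟨
    length (upTo n)                     ≡⟨ ↭-length ham ⟨
    suc (length t)                      ≡⟨ cong suc (length-edgeLengths 0 t) ⟨
    suc (length (edgeLengths (0 ∷ t)))  ≡⟨ cong suc (↭-length eL) ⟩
    suc (length L)                      ∎

ladder : (ℕ → ℕ) → (ℕ → ℕ) → List ℕ → List ℕ
ladder f g σ = map f σ ++ map g (reverse σ)

ladder-∷ : ∀ f g a σ → ladder f g (a ∷ σ) ≡ f a ∷ ladder f g σ ++ g a ∷ []
ladder-∷ f g a σ = cong (f a ∷_) (begin
  map f σ ++ map g (reverse (a ∷ σ))          ≡⟨ cong (λ r → map f σ ++ map g r) (unfold-reverse a σ) ⟩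
  map f σ ++ map g (reverse σ ∷ʳ a)           ≡⟨ cong (map f σ ++_) (map-++ g (reverse σ) (a ∷ [])) ⟩
  map f σ ++ map g (reverse σ) ++ g a ∷ []    ≡⟨ ++-assoc (map f σ) _ _ ⟨
  (map f σ ++ map g (reverse σ)) ++ g a ∷ []  ∎)
  where open ≡-Reasoning

reverse-ladder : ∀ f g σ → reverse (ladder f g σ) ≡ ladder g f σ
reverse-ladder f g σ = begin
  reverse (map f σ ++ map g (reverse σ))            ≡⟨ reverse-++ (map f σ) _ ⟩
  reverse (map g (reverse σ)) ++ reverse (map f σ)  ≡⟨ cong₂ _++_ (reverse-map g (reverse σ)) (reverse-map f σ) ⟨
  map g (reverse (reverse σ)) ++ map f (reverse σ)  ≡⟨ cong (λ r → map g r ++ map f (reverse σ)) (reverse-involutive σ) ⟩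
  map g σ ++ map f (reverse σ)                      ∎
  where open ≡-Reasoning

ladder-↭ : ∀ f g {σ σ′} → σ ↭ σ′ → ladder f g σ ↭ ladder f g σ′
ladder-↭ f g {σ} {σ′} σ↭σ′ =
  ++⁺ (map⁺ f σ↭σ′) (map⁺ g (↭-trans (↭-reverse σ) (↭-trans σ↭σ′ (↭-sym (↭-reverse σ′)))))

module _ {x f g} (f-scales : Scales x f) (g-scales : Scales x g)
         (adjacent : ∀ j → ∣ f j - g j ∣ ≡ 1) where

  private
    xE : List ℕ → List ℕ
    xE σ = map (x *_) (edgeLengths σ)

  edgeLengths-ladder-∷ʳ : ∀ σ v → edgeLengths (ladder f g (σ ∷ʳ v)) ↭ 1 ∷ xE (σ ∷ʳ v) ++ xE (σ ∷ʳ v)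
  edgeLengths-ladder-∷ʳ σ v = begin
    edgeLengths (map f (σ ∷ʳ v) ++ map g (reverse (σ ∷ʳ v)))
      ≡⟨ cong₂ (λ u r → edgeLengths (u ++ map g r)) (map-++ f σ (v ∷ [])) (reverse-++ σ (v ∷ [])) ⟩
    edgeLengths (map f σ ∷ʳ f v ++ g v ∷ map g (reverse σ))
      ≡⟨ edgeLengths-∷ʳ-++ (map f σ) (f v) (g v) _ ⟩
    edgeLengths (map f σ ∷ʳ f v) ++ ∣ f v - g v ∣ ∷ edgeLengths (map g (v ∷ reverse σ))
      ↭⟨ shift _ (edgeLengths (map f σ ∷ʳ f v)) _ ⟩
    ∣ f v - g v ∣ ∷ edgeLengths (map f σ ∷ʳ f v) ++ edgeLengths (map g (v ∷ reverse σ))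
      ≡⟨ cong₂ (λ u r → ∣ f v - g v ∣ ∷ edgeLengths u ++ edgeLengths (map g r))
               (map-++ f σ (v ∷ [])) (reverse-++ σ (v ∷ [])) ⟨
    ∣ f v - g v ∣ ∷ edgeLengths (map f (σ ∷ʳ v)) ++ edgeLengths (map g (reverse (σ ∷ʳ v)))
      ≡⟨ cong₂ (λ d r → d ∷ edgeLengths (map f (σ ∷ʳ v)) ++ edgeLengths r)
               (adjacent v) (reverse-map g (σ ∷ʳ v)) ⟩
    1 ∷ edgeLengths (map f (σ ∷ʳ v)) ++ edgeLengths (reverse (map g (σ ∷ʳ v)))
      ≡⟨ cong (λ r → 1 ∷ edgeLengths (map f (σ ∷ʳ v)) ++ r) (edgeLengths-reverse (map g (σ ∷ʳ v))) ⟩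
    1 ∷ edgeLengths (map f (σ ∷ʳ v)) ++ reverse (edgeLengths (map g (σ ∷ʳ v)))
      ↭⟨ ↭-prep 1 (++⁺ˡ (edgeLengths (map f (σ ∷ʳ v))) (↭-reverse _)) ⟩
    1 ∷ edgeLengths (map f (σ ∷ʳ v)) ++ edgeLengths (map g (σ ∷ʳ v))
      ≡⟨ cong₂ (λ u r → 1 ∷ u ++ r) (edgeLengths-map {x} f-scales (σ ∷ʳ v)) (edgeLengths-map {x} g-scales (σ ∷ʳ v)) ⟩
    1 ∷ xE (σ ∷ʳ v) ++ xE (σ ∷ʳ v) ∎
    where open PermutationReasoning

  edgeLengths-ladder : ∀ a σ → edgeLengths (ladder f g (a ∷ σ)) ↭ 1 ∷ xE (a ∷ σ) ++ xE (a ∷ σ)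
  edgeLengths-ladder a σ with initLast σ
  ... | []      = edgeLengths-ladder-∷ʳ [] a
  ... | τ ∷ʳ′ v = edgeLengths-ladder-∷ʳ (a ∷ τ) v

  replace-ladder : ∀ {n L A B w M σ} →
    IsStdLinReal n L (A ++ ladder f g (upTo (suc w)) ++ B) → IsStdLinReal (suc w) M σ →
    HasStdLinReal ((L ∖ replicate (2 * w) x) ++ map (x *_) M ++ map (x *_) M)
  replace-ladder {w = w} {M} real ((hamσ , (τ , refl)) , eσ) =
    IsStdLinReal⇒HasStdLinReal
      (replace-interior {D = replicate (2 * w) x} {C = 1 ∷ []} {Y = xM ++ xM} (ladder-∷ f g 0 (applyUpTo suc w)) (ladder-∷ f g 0 τ)
                        (ladder-↭ f g (drop-∷ hamσ)) old-lengths new-lengths real)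
    where
    open PermutationReasoning
    xM = map (x *_) M

    xE-upTo : xE (upTo (suc w)) ≡ replicate w x
    xE-upTo = trans (cong (map (x *_)) (edgeLengths-applyUpTo {f = λ i → i} (λ _ → refl) w))
                    (trans (map-replicate (x *_) w 1) (cong (replicate w) (*-identityʳ x)))

    old-lengths : edgeLengths (ladder f g (upTo (suc w))) ↭ replicate (2 * w) x ∷ʳ 1
    old-lengths = begin
      edgeLengths (ladder f g (upTo (suc w)))  ↭⟨ edgeLengths-ladder 0 (applyUpTo suc w) ⟩
      1 ∷ xE (upTo (suc w)) ++ xE (upTo (suc w)) ≡⟨ cong (λ r → 1 ∷ r ++ r) xE-upTo ⟩
      1 ∷ replicate w x ++ replicate w x       ↭⟨ ∷↭∷ʳ 1 _ ⟩
      (replicate w x ++ replicate w x) ∷ʳ 1     ≡⟨ cong (_∷ʳ 1) (replicate-+ w w x) ⟨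
      replicate (w + w) x ∷ʳ 1                  ≡⟨ cong (λ m → replicate (w + m) x ∷ʳ 1) (+-identityʳ w) ⟨
      replicate (2 * w) x ∷ʳ 1                  ∎

    new-lengths : edgeLengths (ladder f g (0 ∷ τ)) ↭ (xM ++ xM) ∷ʳ 1
    new-lengths = begin
      edgeLengths (ladder f g (0 ∷ τ)) ↭⟨ edgeLengths-ladder 0 τ ⟩
      1 ∷ xE (0 ∷ τ) ++ xE (0 ∷ τ)      ↭⟨ ↭-prep 1 (++⁺ (map⁺ (x *_) eσ) (map⁺ (x *_) eσ)) ⟩
      1 ∷ xM ++ xM                      ↭⟨ ∷↭∷ʳ 1 _ ⟩
      (xM ++ xM) ∷ʳ 1                   ∎

column : (x s c : ℕ) → ℕ → ℕ
column x s c j = (s + j) * x + c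

column-scales : ∀ x s c → Scales x (column x s c)
column-scales x s c a b = begin
  ∣ (s + a) * x + c - (s + b) * x + c ∣  ≡⟨ cong₂ ∣_-_∣ (+-comm _ c) (+-comm _ c) ⟩
  ∣ c + (s + a) * x - c + (s + b) * x ∣  ≡⟨ ∣m+n-m+o∣≡∣n-o∣ c _ _ ⟩
  ∣ (s + a) * x - (s + b) * x ∣          ≡⟨ *-distribʳ-∣-∣ x (s + a) (s + b) ⟨
  ∣ s + a - s + b ∣ * x                  ≡⟨ cong (_* x) (∣m+n-m+o∣≡∣n-o∣ s a b) ⟩
  ∣ a - b ∣ * x                          ≡⟨ *-comm _ x ⟩
  x * ∣ a - b ∣                          ∎
  where open ≡-Reasoning

column-adjacent : ∀ x s c j → ∣ column x s c j - column x s (suc c) j ∣ ≡ 1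
column-adjacent x s c j = trans (∣m+n-m+o∣≡∣n-o∣ ((s + j) * x) c (suc c)) (∣n-suc[n]∣≡1 c)

-- segment x k s w is definitionally ladder (column x s k) (column x s (suc k)) (upTo (suc w)).
lemma4p2 : (x n : ℕ) → (hx : x ≥ 2) → n ≥ 1 →
    (L P : List ℕ) → length L ≡ n ∸ 1 → IsStdLinReal n L P →
    (k qs s : ℕ) → suc k < x →
    qstar n x k {{Data.Nat.>-nonZero (m<n⇒0<n hx)}} ≡ + qs →
    qstar n x (suc k) {{Data.Nat.>-nonZero (m<n⇒0<n hx)}} ≡ + qs →
    s ≤ qs →
    (IsInfix (segment x k s (qs ∸ s)) P ⊎ IsInfix (reverse (segment x k s (qs ∸ s))) P) →
    (M : List ℕ) → length M ≡ qs ∸ s → HasStdLinReal M →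
    HasStdLinReal ((L ∖ replicate (2 * (qs ∸ s)) x) ++ map (x *_) M ++ map (x *_) M)
lemma4p2 x _ _ _ _ _ _ real k _ s _ _ _ _ (inj₁ (_ , _ , refl)) M |M| (σ , realM) =
  replace-ladder (column-scales x s k) (column-scales x s (suc k)) (column-adjacent x s k)
    real (subst (λ m → IsStdLinReal (suc m) M σ) |M| realM)
lemma4p2 x n _ _ L _ _ real k qs s _ _ _ _ (inj₂ (A , B , refl)) M |M| (σ , realM) =
  replace-ladder (column-scales x s (suc k)) (column-scales x s k)
    (λ j → trans (∣-∣-comm (column x s (suc k) j) _) (column-adjacent x s k j))
    (subst (λ T → IsStdLinReal n L (A ++ T ++ B)) (reverse-ladder _ _ (upTo (suc (qs ∸ s)))) real)
    (subst (λ m → IsStdLinReal (suc m) M σ) |M| realM)
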